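{- Let $\mathbf{K}=(K,+,;,\rightarrow,0,1)$ and $\mathbf{T}=(T,+,;,\rightarrow,0,1)$ be complete residuated lattices with $T\subseteq K$, where the join, multiplication, $0$ and $1$ of $\mathbf{T}$ are the restrictions of those of $\mathbf{K}$, and suppose $a;b=b;a$ and $a;a=a$ for all $a,b\in T$. Let $\Sigma$ be an alphabet. Then $\mathbf{FLANG}(\mathbf{K},\mathbf{T})=(K^{\Sigma^*},T^{\Sigma^*}_{\epsilon},\cup,\cdot,{}^*,\rightarrow,\varnothing,\epsilon)$ is an idempotent graded Kleene algebra with tests (I-GKAT).
   Context: A complete residuated lattice $(W,+,;,\rightarrow,0,1)$ is a complete lattice on $W$ with binary join $+$ (arbitrary joins written $\sum$), least element $0$ and greatest element $1$, together with an associative multiplication $;$ having $1$ as two-sided unit and distributing over arbitrary joins on both sides, and a binary operation $\rightarrow$ with $a;b\leq c\Leftrightarrow b\leq a\rightarrow c$. $\Sigma^*$ is the set of finite words over $\Sigma$, with empty word also written $\epsilon$. $K^{\Sigma^*}$ is the set of functions $\Sigma^*\to K$ (fuzzy languages); $T^{\Sigma^*}_{\epsilon}$ is the set of functions $\iota:\Sigma^*\to T$ with $\iota(w)=0$ for every nonempty word $w$. Operations: $(\lambda_1\cup\lambda_2)(w)=\lambda_1(w)+\lambda_2(w)$; $(\lambda_1\cdot\lambda_2)(w)=\sum_{w=uv}\lambda_1(u);\lambda_2(v)$, the join over all factorizations $w=uv$ with $u,v\in\Sigma^*$ (possibly empty); $\lambda^*(w)=\sum_{k\geq0}\lambda^k(w)$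 with $\lambda^0=\epsilon$, $\lambda^{k+1}=\lambda^k\cdot\lambda$; for $\iota_1,\iota_2\in T^{\Sigma^*}_\epsilon$: $(\iota_1\rightarrow\iota_2)(\epsilon)=\iota_1(\epsilon)\rightarrow\iota_2(\epsilon)$ (residuum of $\mathbf{T}$) and $(\iota_1\rightarrow\iota_2)(w)=0$ for $w\neq\epsilon$; $\varnothing(w)=0$; $\epsilon(w)=1$ if $w$ is the empty word and $0$ otherwise. A GKAT is a tuple $(K',T',+,;,{}^*,\rightarrow,0,1)$ where $K'$ is a set, $T'\subseteq K'$, $0,1\in T'$, $+$ and $;$ are binary operations on $K'$ under which $T'$ is closed, ${}^*$ is unary on $K'$, and $\rightarrow$ is a binary operation on $T'$ with values in $T'$, such that for all $p,q,r\in K'$ and $a,b,c\in T'$: $p+(q+r)=(p+q)+r$; $p+q=q+p$; $p;(q;r)=(p;q);r$; $p;1=1;p=p$; $p;(q+r)=p;q+p;r$; $(p+q);r=p;r+q;r$; $p;0=0;p=0$; $1+p;p^*=p^*$; $q+p;r\leq r\Rightarrow p^*;q\leq r$; $q+r;p\leq r\Rightarrow q;p^*\leq r$; $a;b\leq c\Leftrightarrow b\leq a\rightarrow c$; $a\leq 1$; $a;b=b;a$, where $p\leq q$ means $p+q=q$. An I-GKAT is a GKAT additionally satisfying $a;a=a$ for all $a\in T'$. -}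

module Defs where

open import Data.Nat using (ℕ; zero; suc)
open import Data.List using (List; []; _∷_; _++_)
open import Data.Product using (Σ; _×_; _,_)
open import Relation.Binary.PropositionalEquality using (_≡_)
open import Relation.Binary.Structures using (IsPartialOrder; IsEquivalence)
open import Function.Definitions using (Injective)

-- Complete residuated lattices (carrier in Set, equality ≡).
-- Arbitrary joins ⋁ are indexed by any type I : Set (this covers all
-- subsets P : Carrier → Set via I = Σ Carrier P).

record CRL : Set₁ where
  infixl 6 _+_
  infixl 7 _︔_
  infixr 5 _⇒_
  infix 4 _≤_
  field
    Carrier : Set
    _≤_     : Carrier → Carrier → Set
    _+_     : Carrier → Carrier → Carrier
    ⋁       : {I : Set} → (I → Carrier) → Carrier
    _︔_     : Carrier → Carrier → Carrier
    _⇒_     : Carrier → Carrier → Carrier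
    𝟘 𝟙     : Carrier
    isPartialOrder : IsPartialOrder _≡_ _≤_
    +-ub₁   : ∀ a b → a ≤ a + b
    +-ub₂   : ∀ a b → b ≤ a + b
    +-least : ∀ a b c → a ≤ c → b ≤ c → a + b ≤ c
    ⋁-ub    : ∀ {I : Set} (f : I → Carrier) (i : I) → f i ≤ ⋁ f
    ⋁-least : ∀ {I : Set} (f : I → Carrier) (c : Carrier) →
              (∀ i → f i ≤ c) → ⋁ f ≤ c
    𝟘-least : ∀ a → 𝟘 ≤ a
    𝟙-great : ∀ a → a ≤ 𝟙
    ︔-assoc : ∀ a b c → a ︔ (b ︔ c) ≡ (a ︔ b) ︔ c
    ︔-unitˡ : ∀ a → 𝟙 ︔ a ≡ a
    ︔-unitʳ : ∀ a → a ︔ 𝟙 ≡ a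
    ︔-distribˡ-⋁ : ∀ {I : Set} (a : Carrier) (f : I → Carrier) →
                   a ︔ ⋁ f ≡ ⋁ (λ i → a ︔ f i)
    ︔-distribʳ-⋁ : ∀ {I : Set} (f : I → Carrier) (a : Carrier) →
                   ⋁ f ︔ a ≡ ⋁ (λ i → f i ︔ a)
    residuation₁ : ∀ a b c → a ︔ b ≤ c → b ≤ a ⇒ c
    residuation₂ : ∀ a b c → b ≤ a ⇒ c → a ︔ b ≤ c

-- T' ⊆ K' is represented by a type T' together with
-- an inclusion emb : T' → K'; all equations are read in K' through emb.
-- Equality on K' is a setoid equality ≈ (needed since K' will be a
-- function space), and the operations are required to respect it.

module _ {K' T' : Set} (_≈_ : K' → K' → Set) (emb : T' → K')
         (_+_ _︔_ : K' → K' → K') (_* : K' → K')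
         (_+ₜ_ _︔ₜ_ _⇒_ : T' → T' → T') (0ₜ 1ₜ : T') where

  private
    𝟘 𝟙 : K'
    𝟘 = emb 0ₜ
    𝟙 = emb 1ₜ
    _≤_ : K' → K' → Set
    p ≤ q = (p + q) ≈ q

  record IsGKAT : Set where
    field
      isEquivalence : IsEquivalence _≈_
      +-cong  : ∀ {p p' q q'} → p ≈ p' → q ≈ q' → (p + q) ≈ (p' + q')
      ︔-cong  : ∀ {p p' q q'} → p ≈ p' → q ≈ q' → (p ︔ q) ≈ (p' ︔ q')
      *-cong  : ∀ {p p'} → p ≈ p' → (p *) ≈ (p' *)
      ⇒-cong  : ∀ {a a' b b'} → emb a ≈ emb a' → emb b ≈ emb b' →
                emb (a ⇒ b) ≈ emb (a' ⇒ b')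
      +ₜ-emb  : ∀ a b → emb (a +ₜ b) ≈ (emb a + emb b)
      ︔ₜ-emb  : ∀ a b → emb (a ︔ₜ b) ≈ (emb a ︔ emb b)
      +-assoc : ∀ p q r → (p + (q + r)) ≈ ((p + q) + r)
      +-comm  : ∀ p q → (p + q) ≈ (q + p)
      ︔-assoc : ∀ p q r → (p ︔ (q ︔ r)) ≈ ((p ︔ q) ︔ r)
      ︔-unitʳ : ∀ p → (p ︔ 𝟙) ≈ p
      ︔-unitˡ : ∀ p → (𝟙 ︔ p) ≈ p
      distribˡ : ∀ p q r → (p ︔ (q + r)) ≈ ((p ︔ q) + (p ︔ r))
      distribʳ : ∀ p q r → ((p + q) ︔ r) ≈ ((p ︔ r) + (q ︔ r))
      zeroʳ   : ∀ p → (p ︔ 𝟘) ≈ 𝟘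
      zeroˡ   : ∀ p → (𝟘 ︔ p) ≈ 𝟘
      star-unfold : ∀ p → (𝟙 + (p ︔ (p *))) ≈ (p *)
      star-indˡ : ∀ p q r → (q + (p ︔ r)) ≤ r → ((p *) ︔ q) ≤ r
      star-indʳ : ∀ p q r → (q + (r ︔ p)) ≤ r → (q ︔ (p *)) ≤ r
      residuation₁ : ∀ a b c → (emb a ︔ emb b) ≤ emb c → emb b ≤ emb (a ⇒ c)
      residuation₂ : ∀ a b c → emb b ≤ emb (a ⇒ c) → (emb a ︔ emb b) ≤ emb c
      test-≤𝟙 : ∀ a → emb a ≤ 𝟙
      test-comm : ∀ a b → (emb a ︔ emb b) ≈ (emb b ︔ emb a)

  record IsIGKAT : Set where
    field
      isGKAT : IsGKAT
      test-idem : ∀ a → (emb a ︔ emb a) ≈ emb a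

module FLANG (𝐊 𝐓 : CRL) (e : CRL.Carrier 𝐓 → CRL.Carrier 𝐊) (Σ' : Set) where
  private
    module K = CRL 𝐊
    module T = CRL 𝐓

  Word : Set
  Word = List Σ'

  Lang : Set
  Lang = Word → K.Carrier

  record TLang : Set where
    field
      fn     : Word → T.Carrier
      vanish : ∀ x w → fn (x ∷ w) ≡ T.𝟘
  open TLang public

  embL : TLang → Lang
  embL ι w = e (fn ι w)

  _≈L_ : Lang → Lang → Set
  λ₁ ≈L λ₂ = ∀ w → λ₁ w ≡ λ₂ w

  _∪_ : Lang → Lang → Lang
  (λ₁ ∪ λ₂) w = λ₁ w K.+ λ₂ w

  Factorization : Word → Set
  Factorization w = Σ (Word × Word) (λ { (u , v) → u ++ v ≡ w })

  _·_ : Lang → Lang → Lang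
  (λ₁ · λ₂) w = K.⋁ {Factorization w} (λ { ((u , v) , _) → λ₁ u K.︔ λ₂ v })

  ∅L : Lang
  ∅L w = K.𝟘

  εL : Lang
  εL []      = K.𝟙
  εL (_ ∷ _) = K.𝟘

  _^_ : Lang → ℕ → Lang
  l ^ zero  = εL
  l ^ suc k = (l ^ k) · l

  _⋆ : Lang → Lang
  (l ⋆) w = K.⋁ {ℕ} (λ k → (l ^ k) w)

  ∅T : TLang
  fn ∅T _ = T.𝟘
  vanish ∅T _ _ = _≡_.refl

  εT : TLang
  fn εT []      = T.𝟙
  fn εT (_ ∷ _) = T.𝟘
  vanish εT _ _ = _≡_.refl

  _∪T_ : TLang → TLang → TLang
  fn (ι₁ ∪T ι₂) []      = fn ι₁ [] T.+ fn ι₂ []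
  fn (ι₁ ∪T ι₂) (_ ∷ _) = T.𝟘
  vanish (ι₁ ∪T ι₂) _ _ = _≡_.refl

  _·T_ : TLang → TLang → TLang
  fn (ι₁ ·T ι₂) []      = fn ι₁ [] T.︔ fn ι₂ []
  fn (ι₁ ·T ι₂) (_ ∷ _) = T.𝟘
  vanish (ι₁ ·T ι₂) _ _ = _≡_.refl

  _⇒T_ : TLang → TLang → TLang
  fn (ι₁ ⇒T ι₂) []      = fn ι₁ [] T.⇒ fn ι₂ []
  fn (ι₁ ⇒T ι₂) (_ ∷ _) = T.𝟘
  vanish (ι₁ ⇒T ι₂) _ _ = _≡_.refl

  FLANG-IsIGKAT : Set
  FLANG-IsIGKAT = IsIGKAT _≈L_ embL _∪_ _·_ _⋆ _∪T_ _·T_ _⇒T_ ∅T εT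

-- The Kleene-algebra axioms for K-valued languages are the usual
-- arguments for formal power series over a quantale: every operation is
-- a join, products distribute over joins, and the star is the join of
-- the powers, so unfolding and induction reduce to statements about each
-- power.  Test languages vanish off the empty word, so a product with a
-- test on the left is scalar multiplication by its value at ε; hence all
-- test axioms reduce to the corresponding facts in T, transported along
-- the embedding e, which reflects the order because it is injective and
-- preserves joins.

module Submission where

open import Defs
open import Relation.Binary.PropositionalEquality
  using (_≡_; refl; sym; trans; cong; cong₂; subst; module ≡-Reasoning)
open import Function.Definitions using (Injective)
open import Data.Bool using (Bool; true; false)
open import Data.Empty using (⊥; ⊥-elim)
open import Data.List using ([]; _∷_; _++_)
open import Data.List.Properties using (++-assoc; ++-identityʳ)
open import Data.Nat using (zero; suc)
open import Data.Product using (_×_; _,_; proj₁; proj₂)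
open import Relation.Binary.Bundles using (Poset)
open import Relation.Binary.Structures using (IsPartialOrder; IsEquivalence)
import Relation.Binary.Reasoning.PartialOrder as PosetReasoning

module CRL-Properties (𝐊 : CRL) where
  open CRL 𝐊

  open IsPartialOrder isPartialOrder public
    using (reflexive) renaming (refl to ≤-refl; trans to ≤-trans; antisym to ≤-antisym)

  poset : Poset _ _ _
  poset = record { isPartialOrder = isPartialOrder }

  module ≤-Reasoning = PosetReasoning poset

  x≤y⇒x+y≡y : ∀ {a b} → a ≤ b → a + b ≡ b
  x≤y⇒x+y≡y {a} {b} a≤b = ≤-antisym (+-least a b b a≤b ≤-refl) (+-ub₂ a b)

  x+y≡y⇒x≤y : ∀ {a b} → a + b ≡ b → a ≤ b
  x+y≡y⇒x≤y {a} {b} eq = subst (a ≤_) eq (+-ub₁ a b)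

  +-mono-≤ : ∀ {a b c d} → a ≤ b → c ≤ d → a + c ≤ b + d
  +-mono-≤ {b = b} {d = d} a≤b c≤d =
    +-least _ _ _ (≤-trans a≤b (+-ub₁ b d)) (≤-trans c≤d (+-ub₂ b d))

  +-comm : ∀ a b → a + b ≡ b + a
  +-comm a b = ≤-antisym (+-least a b _ (+-ub₂ b a) (+-ub₁ b a))
                         (+-least b a _ (+-ub₂ a b) (+-ub₁ a b))

  +-assoc : ∀ a b c → a + (b + c) ≡ (a + b) + c
  +-assoc a b c = ≤-antisym
    (+-least _ _ _ (≤-trans (+-ub₁ a b) (+-ub₁ _ c)) (+-mono-≤ (+-ub₂ a b) ≤-refl))
    (+-least _ _ _ (+-mono-≤ ≤-refl (+-ub₁ b c)) (≤-trans (+-ub₂ b c) (+-ub₂ a _)))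

  +-identityˡ : ∀ a → 𝟘 + a ≡ a
  +-identityˡ a = x≤y⇒x+y≡y (𝟘-least a)

  ≡𝟘⇒≤ : ∀ {a} → a ≡ 𝟘 → ∀ b → a ≤ b
  ≡𝟘⇒≤ refl = 𝟘-least

  ⋁-mono-≤ : ∀ {I : Set} {f g : I → Carrier} → (∀ i → f i ≤ g i) → ⋁ f ≤ ⋁ g
  ⋁-mono-≤ {f = f} {g} f≤g = ⋁-least f (⋁ g) (λ i → ≤-trans (f≤g i) (⋁-ub g i))

  ⋁-cong : ∀ {I : Set} {f g : I → Carrier} → (∀ i → f i ≡ g i) → ⋁ f ≡ ⋁ g
  ⋁-cong f≡g = ≤-antisym (⋁-mono-≤ (λ i → reflexive (f≡g i)))
                         (⋁-mono-≤ (λ i → reflexive (sym (f≡g i))))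

  ⋁-𝟘 : ∀ {I : Set} (f : I → Carrier) → (∀ i → f i ≡ 𝟘) → ⋁ f ≡ 𝟘
  ⋁-𝟘 f f≡𝟘 = ≤-antisym (⋁-least f 𝟘 (λ i → reflexive (f≡𝟘 i))) (𝟘-least _)

  -- 𝟘 and + are the joins indexed by ⊥ and Bool, so ︔ inherits their
  -- distributivity from that over ⋁.
  𝟘≡⋁⊥ : 𝟘 ≡ ⋁ {⊥} ⊥-elim
  𝟘≡⋁⊥ = sym (⋁-𝟘 ⊥-elim (λ ()))

  if : Carrier → Carrier → Bool → Carrier
  if a b true  = a
  if a b false = b

  +≡⋁Bool : ∀ a b → a + b ≡ ⋁ (if a b)
  +≡⋁Bool a b = ≤-antisym
    (+-least a b _ (⋁-ub (if a b) true) (⋁-ub (if a b) false))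
    (⋁-least _ _ λ { true → +-ub₁ a b ; false → +-ub₂ a b })

  ︔-zeroʳ : ∀ a → a ︔ 𝟘 ≡ 𝟘
  ︔-zeroʳ a = trans (cong (a ︔_) 𝟘≡⋁⊥) (trans (︔-distribˡ-⋁ a ⊥-elim) (⋁-𝟘 _ λ ()))

  ︔-zeroˡ : ∀ a → 𝟘 ︔ a ≡ 𝟘
  ︔-zeroˡ a = trans (cong (_︔ a) 𝟘≡⋁⊥) (trans (︔-distribʳ-⋁ ⊥-elim a) (⋁-𝟘 _ λ ()))

  ︔-distribˡ-+ : ∀ a b c → a ︔ (b + c) ≡ a ︔ b + a ︔ c
  ︔-distribˡ-+ a b c = begin
    a ︔ (b + c)                  ≡⟨ cong (a ︔_) (+≡⋁Bool b c) ⟩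
    a ︔ ⋁ (if b c)               ≡⟨ ︔-distribˡ-⋁ a (if b c) ⟩
    ⋁ (λ i → a ︔ if b c i)       ≡⟨ ⋁-cong (λ { true → refl ; false → refl }) ⟩
    ⋁ (if (a ︔ b) (a ︔ c))       ≡⟨ sym (+≡⋁Bool _ _) ⟩
    a ︔ b + a ︔ c                ∎
    where open ≡-Reasoning

  ︔-distribʳ-+ : ∀ a b c → (b + c) ︔ a ≡ b ︔ a + c ︔ a
  ︔-distribʳ-+ a b c = begin
    (b + c) ︔ a                  ≡⟨ cong (_︔ a) (+≡⋁Bool b c) ⟩
    ⋁ (if b c) ︔ a               ≡⟨ ︔-distribʳ-⋁ (if b c) a ⟩
    ⋁ (λ i → if b c i ︔ a)       ≡⟨ ⋁-cong (λ { true → refl ; false → refl }) ⟩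
    ⋁ (if (b ︔ a) (c ︔ a))       ≡⟨ sym (+≡⋁Bool _ _) ⟩
    b ︔ a + c ︔ a                ∎
    where open ≡-Reasoning

  ︔-monoʳ-≤ : ∀ {a b c} → b ≤ c → a ︔ b ≤ a ︔ c
  ︔-monoʳ-≤ {a} {b} {c} b≤c = subst (a ︔ b ≤_)
    (trans (sym (︔-distribˡ-+ a b c)) (cong (a ︔_) (x≤y⇒x+y≡y b≤c))) (+-ub₁ _ _)

  ︔-monoˡ-≤ : ∀ {a b c} → b ≤ c → b ︔ a ≤ c ︔ a
  ︔-monoˡ-≤ {a} {b} {c} b≤c = subst (b ︔ a ≤_)
    (trans (sym (︔-distribʳ-+ a b c)) (cong (_︔ a) (x≤y⇒x+y≡y b≤c))) (+-ub₁ _ _)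

  ︔-mono-≤ : ∀ {a b c d} → a ≤ b → c ≤ d → a ︔ c ≤ b ︔ d
  ︔-mono-≤ a≤b c≤d = ≤-trans (︔-monoˡ-≤ a≤b) (︔-monoʳ-≤ c≤d)

-- The operations on K-valued languages do not involve T or e; FLANG is
-- merely parameterised by them.
module LanguageProperties (𝐊 𝐓 : CRL) (e : CRL.Carrier 𝐓 → CRL.Carrier 𝐊) (Σ' : Set) where
  open CRL 𝐊
  open CRL-Properties 𝐊
  open FLANG 𝐊 𝐓 e Σ'

  infix 4 _⊑_
  _⊑_ : Lang → Lang → Set
  p ⊑ q = ∀ w → p w ≤ q w

  ≈L-isEquivalence : IsEquivalence _≈L_
  ≈L-isEquivalence = record
    { refl = λ w → refl ; sym = λ eq w → sym (eq w) ; trans = λ eq eq' w → trans (eq w) (eq' w) }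

  open IsEquivalence ≈L-isEquivalence public
    using () renaming (refl to ≈L-refl; sym to ≈L-sym; trans to ≈L-trans)

  ≈L⇒⊑ : ∀ {p q} → p ≈L q → p ⊑ q
  ≈L⇒⊑ eq w = reflexive (eq w)

  ⊑-antisym : ∀ {p q} → p ⊑ q → q ⊑ p → p ≈L q
  ⊑-antisym p⊑q q⊑p w = ≤-antisym (p⊑q w) (q⊑p w)

  ⊑-trans : ∀ {p q r} → p ⊑ q → q ⊑ r → p ⊑ r
  ⊑-trans p⊑q q⊑r w = ≤-trans (p⊑q w) (q⊑r w)

  ⊑⇒∪≈L : ∀ {p q} → p ⊑ q → (p ∪ q) ≈L q
  ⊑⇒∪≈L p⊑q w = x≤y⇒x+y≡y (p⊑q w)

  ∪≈L⇒⊑ : ∀ {p q} → (p ∪ q) ≈L q → p ⊑ q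
  ∪≈L⇒⊑ eq w = x+y≡y⇒x≤y (eq w)

  ∪-⊑⁻ : ∀ {p q r} → p ∪ q ⊑ r → p ⊑ r × q ⊑ r
  ∪-⊑⁻ p∪q⊑r = (λ w → ≤-trans (+-ub₁ _ _) (p∪q⊑r w)) , (λ w → ≤-trans (+-ub₂ _ _) (p∪q⊑r w))

  ∪-cong : ∀ {p p' q q'} → p ≈L p' → q ≈L q' → (p ∪ q) ≈L (p' ∪ q')
  ∪-cong p≈p' q≈q' w = cong₂ _+_ (p≈p' w) (q≈q' w)

  ∪-assoc : ∀ p q r → (p ∪ (q ∪ r)) ≈L ((p ∪ q) ∪ r)
  ∪-assoc p q r w = +-assoc (p w) (q w) (r w)

  ∪-comm : ∀ p q → (p ∪ q) ≈L (q ∪ p)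
  ∪-comm p q w = +-comm (p w) (q w)

  factor≤· : ∀ p q {w} u v → u ++ v ≡ w → p u ︔ q v ≤ (p · q) w
  factor≤· p q u v uv≡w = ⋁-ub _ ((u , v) , uv≡w)

  ·-least : ∀ p q w {c} → (∀ u v → u ++ v ≡ w → p u ︔ q v ≤ c) → (p · q) w ≤ c
  ·-least p q w bound = ⋁-least _ _ λ { ((u , v) , uv≡w) → bound u v uv≡w }

  ^≤⋆ : ∀ p k w → (p ^ k) w ≤ (p ⋆) w
  ^≤⋆ p k w = ⋁-ub (λ k → (p ^ k) w) k

  ·-mono : ∀ {p p' q q'} → p ⊑ p' → q ⊑ q' → p · q ⊑ p' · q'
  ·-mono {p} {p'} {q} {q'} p⊑p' q⊑q' w = ·-least p q w λ u v uv≡w →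
    ≤-trans (︔-mono-≤ (p⊑p' u) (q⊑q' v)) (factor≤· p' q' u v uv≡w)

  ·-cong : ∀ {p p' q q'} → p ≈L p' → q ≈L q' → (p · q) ≈L (p' · q')
  ·-cong p≈p' q≈q' = ⊑-antisym (·-mono (≈L⇒⊑ p≈p') (≈L⇒⊑ q≈q'))
                               (·-mono (≈L⇒⊑ (≈L-sym p≈p')) (≈L⇒⊑ (≈L-sym q≈q')))

  ^-cong : ∀ {p p'} → p ≈L p' → ∀ k → (p ^ k) ≈L (p' ^ k)
  ^-cong p≈p' zero    = ≈L-refl
  ^-cong p≈p' (suc k) = ·-cong (^-cong p≈p' k) p≈p'

  ⋆-cong : ∀ {p p'} → p ≈L p' → (p ⋆) ≈L (p' ⋆)
  ⋆-cong p≈p' w = ⋁-cong (λ k → ^-cong p≈p' k w)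

  ·-distribˡ-∪ : ∀ p q r → (p · (q ∪ r)) ≈L ((p · q) ∪ (p · r))
  ·-distribˡ-∪ p q r w = ≤-antisym
    (·-least p (q ∪ r) w λ u v uv≡w → ≤-trans (reflexive (︔-distribˡ-+ (p u) (q v) (r v)))
      (+-mono-≤ (factor≤· p q u v uv≡w) (factor≤· p r u v uv≡w)))
    (+-least _ _ _ (·-mono (λ _ → ≤-refl) (λ _ → +-ub₁ _ _) w) (·-mono (λ _ → ≤-refl) (λ _ → +-ub₂ _ _) w))

  ·-distribʳ-∪ : ∀ p q r → ((p ∪ q) · r) ≈L ((p · r) ∪ (q · r))
  ·-distribʳ-∪ p q r w = ≤-antisym
    (·-least (p ∪ q) r w λ u v uv≡w → ≤-trans (reflexive (︔-distribʳ-+ (r v) (p u) (q u)))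
      (+-mono-≤ (factor≤· p r u v uv≡w) (factor≤· q r u v uv≡w)))
    (+-least _ _ _ (·-mono (λ _ → +-ub₁ _ _) (λ _ → ≤-refl) w) (·-mono (λ _ → +-ub₂ _ _) (λ _ → ≤-refl) w))

  ·-zeroˡ : ∀ p → (∅L · p) ≈L ∅L
  ·-zeroˡ p w = ≤-antisym (·-least ∅L p w λ u v _ → reflexive (︔-zeroˡ (p v))) (𝟘-least _)

  ·-zeroʳ : ∀ p → (p · ∅L) ≈L ∅L
  ·-zeroʳ p w = ≤-antisym (·-least p ∅L w λ u v _ → reflexive (︔-zeroʳ (p u))) (𝟘-least _)

  ·-identityˡ : ∀ p → (εL · p) ≈L p
  ·-identityˡ p w = ≤-antisym (·-least εL p w factor≤)
    (≤-trans (reflexive (sym (︔-unitˡ (p w)))) (factor≤· εL p [] w refl))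
    where
    factor≤ : ∀ u v → u ++ v ≡ w → εL u ︔ p v ≤ p w
    factor≤ []      v refl = reflexive (︔-unitˡ (p v))
    factor≤ (_ ∷ _) v _    = ≡𝟘⇒≤ (︔-zeroˡ (p v)) (p w)

  ·-identityʳ : ∀ p → (p · εL) ≈L p
  ·-identityʳ p w = ≤-antisym (·-least p εL w factor≤)
    (≤-trans (reflexive (sym (︔-unitʳ (p w)))) (factor≤· p εL w [] (++-identityʳ w)))
    where
    factor≤ : ∀ u v → u ++ v ≡ w → p u ︔ εL v ≤ p w
    factor≤ u []      u[]≡w = reflexive (trans (︔-unitʳ (p u)) (cong p (trans (sym (++-identityʳ u)) u[]≡w)))
    factor≤ u (_ ∷ _) _     = ≡𝟘⇒≤ (︔-zeroʳ (p u)) (p w)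

  ·-assoc : ∀ p q r → ((p · q) · r) ≈L (p · (q · r))
  ·-assoc p q r w = ≤-antisym
    (·-least (p · q) r w λ x v xv≡w → begin
      (p · q) x ︔ r v                         ≡⟨ ︔-distribʳ-⋁ _ (r v) ⟩
      ⋁ (λ { ((u , y) , _) → p u ︔ q y ︔ r v }) ≤⟨ ⋁-least _ _ (λ { ((u , y) , uy≡x) → begin
        p u ︔ q y ︔ r v       ≡⟨ sym (︔-assoc (p u) (q y) (r v)) ⟩
        p u ︔ (q y ︔ r v)     ≤⟨ ︔-monoʳ-≤ (factor≤· q r y v refl) ⟩
        p u ︔ (q · r) (y ++ v) ≤⟨ factor≤· p (q · r) u (y ++ v)
                                   (trans (sym (++-assoc u y v)) (trans (cong (_++ v) uy≡x) xv≡w)) ⟩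
        (p · (q · r)) w        ∎ }) ⟩
      (p · (q · r)) w                         ∎)
    (·-least p (q · r) w λ u x ux≡w → begin
      p u ︔ (q · r) x                         ≡⟨ ︔-distribˡ-⋁ (p u) _ ⟩
      ⋁ (λ { ((y , v) , _) → p u ︔ (q y ︔ r v) }) ≤⟨ ⋁-least _ _ (λ { ((y , v) , yv≡x) → begin
        p u ︔ (q y ︔ r v)     ≡⟨ ︔-assoc (p u) (q y) (r v) ⟩
        p u ︔ q y ︔ r v       ≤⟨ ︔-monoˡ-≤ (factor≤· p q u y refl) ⟩
        (p · q) (u ++ y) ︔ r v ≤⟨ factor≤· (p · q) r (u ++ y) v
                                   (trans (++-assoc u y v) (trans (cong (u ++_) yv≡x) ux≡w)) ⟩
        ((p · q) · r) w        ∎ }) ⟩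
      ((p · q) · r) w                         ∎)
    where open ≤-Reasoning

  ·-^-comm : ∀ p k → (p · (p ^ k)) ≈L ((p ^ k) · p)
  ·-^-comm p zero    = ≈L-trans (·-identityʳ p) (≈L-sym (·-identityˡ p))
  ·-^-comm p (suc k) = ≈L-trans (≈L-sym (·-assoc p (p ^ k) p)) (·-cong (·-^-comm p k) ≈L-refl)

  ⋆-unfold : ∀ p → (εL ∪ (p · (p ⋆))) ≈L (p ⋆)
  ⋆-unfold p w = ≤-antisym
    (+-least _ _ _ (^≤⋆ p 0 w) (·-least p (p ⋆) w λ u v uv≡w → begin
      p u ︔ (p ⋆) v                   ≡⟨ ︔-distribˡ-⋁ (p u) _ ⟩
      ⋁ (λ k → p u ︔ (p ^ k) v)        ≤⟨ ⋁-least _ _ (λ k → begin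
        p u ︔ (p ^ k) v     ≤⟨ factor≤· p (p ^ k) u v uv≡w ⟩
        (p · (p ^ k)) w     ≡⟨ ·-^-comm p k w ⟩
        (p ^ suc k) w       ≤⟨ ^≤⋆ p (suc k) w ⟩
        (p ⋆) w             ∎) ⟩
      (p ⋆) w                         ∎))
    (⋁-least _ _ λ
      { zero    → +-ub₁ _ _
      ; (suc k) → begin
          (p ^ suc k) w        ≡⟨ sym (·-^-comm p k w) ⟩
          (p · (p ^ k)) w      ≤⟨ ·-mono (λ _ → ≤-refl) (^≤⋆ p k) w ⟩
          (p · (p ⋆)) w        ≤⟨ +-ub₂ _ _ ⟩
          (εL ∪ (p · (p ⋆))) w ∎ })
    where open ≤-Reasoning

  ·⋆-least : ∀ p q r → (∀ k → q · (p ^ k) ⊑ r) → q · (p ⋆) ⊑ r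
  ·⋆-least p q r bound w = ·-least q (p ⋆) w λ u v uv≡w →
    ≤-trans (reflexive (︔-distribˡ-⋁ (q u) _))
            (⋁-least _ _ λ k → ≤-trans (factor≤· q (p ^ k) u v uv≡w) (bound k w))

  ⋆·-least : ∀ p q r → (∀ k → (p ^ k) · q ⊑ r) → (p ⋆) · q ⊑ r
  ⋆·-least p q r bound w = ·-least (p ⋆) q w λ u v uv≡w →
    ≤-trans (reflexive (︔-distribʳ-⋁ _ (q v)))
            (⋁-least _ _ λ k → ≤-trans (factor≤· (p ^ k) q u v uv≡w) (bound k w))

  ⋆-inductionˡ : ∀ p q r → q ∪ (p · r) ⊑ r → (p ⋆) · q ⊑ r
  ⋆-inductionˡ p q r q∪pr⊑r = ⋆·-least p q r power
    where
    q⊑r : q ⊑ r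
    q⊑r = proj₁ (∪-⊑⁻ q∪pr⊑r)
    pr⊑r : p · r ⊑ r
    pr⊑r = proj₂ (∪-⊑⁻ q∪pr⊑r)
    power : ∀ k → (p ^ k) · q ⊑ r
    power zero    = ⊑-trans (≈L⇒⊑ (·-identityˡ q)) q⊑r
    power (suc k) = ⊑-trans (≈L⇒⊑ (·-cong (≈L-sym (·-^-comm p k)) ≈L-refl))
                   (⊑-trans (≈L⇒⊑ (·-assoc p (p ^ k) q))
                   (⊑-trans (·-mono (λ _ → ≤-refl) (power k)) pr⊑r))

  ⋆-inductionʳ : ∀ p q r → q ∪ (r · p) ⊑ r → q · (p ⋆) ⊑ r
  ⋆-inductionʳ p q r q∪rp⊑r = ·⋆-least p q r power
    where
    q⊑r : q ⊑ r
    q⊑r = proj₁ (∪-⊑⁻ q∪rp⊑r)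
    rp⊑r : r · p ⊑ r
    rp⊑r = proj₂ (∪-⊑⁻ q∪rp⊑r)
    power : ∀ k → q · (p ^ k) ⊑ r
    power zero    = ⊑-trans (≈L⇒⊑ (·-identityʳ q)) q⊑r
    power (suc k) = ⊑-trans (≈L⇒⊑ (≈L-sym (·-assoc q (p ^ k) p)))
                   (⊑-trans (·-mono (power k) (λ _ → ≤-refl)) rp⊑r)

module TestLanguageProperties
    (𝐊 𝐓 : CRL) (e : CRL.Carrier 𝐓 → CRL.Carrier 𝐊)
    (e-injective : Injective _≡_ _≡_ e)
    (e-+ : ∀ a b → e (CRL._+_ 𝐓 a b) ≡ CRL._+_ 𝐊 (e a) (e b))
    (e-︔ : ∀ a b → e (CRL._︔_ 𝐓 a b) ≡ CRL._︔_ 𝐊 (e a) (e b))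
    (e-𝟘 : e (CRL.𝟘 𝐓) ≡ CRL.𝟘 𝐊)
    (e-𝟙 : e (CRL.𝟙 𝐓) ≡ CRL.𝟙 𝐊)
    (Σ' : Set) where
  open CRL 𝐊
  open CRL-Properties 𝐊
  private
    module T = CRL 𝐓
    module TP = CRL-Properties 𝐓
  open FLANG 𝐊 𝐓 e Σ'
  open LanguageProperties 𝐊 𝐓 e Σ'

  e-mono-≤ : ∀ {a b} → a T.≤ b → e a ≤ e b
  e-mono-≤ {a} {b} a≤b = x+y≡y⇒x≤y (trans (sym (e-+ a b)) (cong e (TP.x≤y⇒x+y≡y a≤b)))

  e-reflects-≤ : ∀ {a b} → e a ≤ e b → a T.≤ b
  e-reflects-≤ {a} {b} ea≤eb = TP.x+y≡y⇒x≤y (e-injective (trans (e-+ a b) (x≤y⇒x+y≡y ea≤eb)))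

  embL-vanish : ∀ ι x w → embL ι (x ∷ w) ≡ 𝟘
  embL-vanish ι x w = trans (cong e (vanish ι x w)) e-𝟘

  embL-≈L : ∀ ι ι' → fn ι [] ≡ fn ι' [] → embL ι ≈L embL ι'
  embL-≈L ι ι' ι≡ι' []      = cong e ι≡ι'
  embL-≈L ι ι' _    (x ∷ w) = trans (embL-vanish ι x w) (sym (embL-vanish ι' x w))

  embL-εT : embL εT ≈L εL
  embL-εT []      = e-𝟙
  embL-εT (_ ∷ _) = e-𝟘

  embL-∅T : embL ∅T ≈L ∅L
  embL-∅T _ = e-𝟘

  test·-scalar : ∀ ι p w → (embL ι · p) w ≡ e (fn ι []) ︔ p w
  test·-scalar ι p w = ≤-antisym (·-least (embL ι) p w factor≤) (factor≤· (embL ι) p [] w refl)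
    where
    factor≤ : ∀ u v → u ++ v ≡ w → embL ι u ︔ p v ≤ e (fn ι []) ︔ p w
    factor≤ []      v refl = ≤-refl
    factor≤ (x ∷ u) v _    =
      ≡𝟘⇒≤ (trans (cong (_︔ p v) (embL-vanish ι x u)) (︔-zeroˡ (p v))) _

  embL-·T : ∀ ι ι' → embL (ι ·T ι') ≈L (embL ι · embL ι')
  embL-·T ι ι' [] = trans (e-︔ _ _) (sym (test·-scalar ι (embL ι') []))
  embL-·T ι ι' (x ∷ w) = begin
    e T.𝟘                           ≡⟨ e-𝟘 ⟩
    𝟘                               ≡⟨ sym (︔-zeroʳ _) ⟩
    e (fn ι []) ︔ 𝟘                 ≡⟨ cong (e (fn ι []) ︔_) (sym (embL-vanish ι' x w)) ⟩
    e (fn ι []) ︔ embL ι' (x ∷ w)   ≡⟨ sym (test·-scalar ι (embL ι') (x ∷ w)) ⟩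
    (embL ι · embL ι') (x ∷ w)      ∎
    where open ≡-Reasoning

  embL-∪T : ∀ ι ι' → embL (ι ∪T ι') ≈L (embL ι ∪ embL ι')
  embL-∪T ι ι' []      = e-+ _ _
  embL-∪T ι ι' (x ∷ w) =
    sym (trans (cong₂ _+_ (embL-vanish ι x w) (embL-vanish ι' x w)) (trans (+-identityˡ 𝟘) (sym e-𝟘)))

  test-⊑ : ∀ ι ι' → fn ι [] T.≤ fn ι' [] → embL ι ⊑ embL ι'
  test-⊑ ι ι' ι≤ι' []      = e-mono-≤ ι≤ι'
  test-⊑ ι ι' ι≤ι' (x ∷ w) = ≡𝟘⇒≤ (embL-vanish ι x w) _

  test-⊑⁻ : ∀ ι ι' → embL ι ⊑ embL ι' → fn ι [] T.≤ fn ι' []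
  test-⊑⁻ ι ι' ι⊑ι' = e-reflects-≤ (ι⊑ι' [])

  test-residuation₁ : ∀ ι₁ ι₂ ι₃ → embL ι₁ · embL ι₂ ⊑ embL ι₃ → embL ι₂ ⊑ embL (ι₁ ⇒T ι₃)
  test-residuation₁ ι₁ ι₂ ι₃ ι₁ι₂⊑ι₃ = test-⊑ ι₂ (ι₁ ⇒T ι₃) (T.residuation₁ _ _ _
    (test-⊑⁻ (ι₁ ·T ι₂) ι₃ (⊑-trans (≈L⇒⊑ (embL-·T ι₁ ι₂)) ι₁ι₂⊑ι₃)))

  test-residuation₂ : ∀ ι₁ ι₂ ι₃ → embL ι₂ ⊑ embL (ι₁ ⇒T ι₃) → embL ι₁ · embL ι₂ ⊑ embL ι₃
  test-residuation₂ ι₁ ι₂ ι₃ ι₂⊑ι₁⇒ι₃ = ⊑-trans (≈L⇒⊑ (≈L-sym (embL-·T ι₁ ι₂)))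
    (test-⊑ (ι₁ ·T ι₂) ι₃ (T.residuation₂ _ _ _ (test-⊑⁻ ι₂ (ι₁ ⇒T ι₃) ι₂⊑ι₁⇒ι₃)))

theorem5 : (𝐊 𝐓 : CRL) (e : CRL.Carrier 𝐓 → CRL.Carrier 𝐊) →
    Injective _≡_ _≡_ e →
    (∀ a b → e (CRL._+_ 𝐓 a b) ≡ CRL._+_ 𝐊 (e a) (e b)) →
    (∀ a b → e (CRL._︔_ 𝐓 a b) ≡ CRL._︔_ 𝐊 (e a) (e b)) →
    e (CRL.𝟘 𝐓) ≡ CRL.𝟘 𝐊 →
    e (CRL.𝟙 𝐓) ≡ CRL.𝟙 𝐊 →
    (∀ a b → CRL._︔_ 𝐓 a b ≡ CRL._︔_ 𝐓 b a) →
    (∀ a → CRL._︔_ 𝐓 a a ≡ a) →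
    (Σ' : Set) → FLANG.FLANG-IsIGKAT 𝐊 𝐓 e Σ'
theorem5 𝐊 𝐓 e e-inj e-+ e-︔ e-𝟘 e-𝟙 T-comm T-idem Σ' = record
  { isGKAT = record
    { isEquivalence = ≈L-isEquivalence
    ; +-cong        = ∪-cong
    ; ︔-cong        = ·-cong
    ; *-cong        = ⋆-cong
    ; ⇒-cong        = λ {ι₁} {ι₁'} {ι₂} {ι₂'} ι₁≈ι₁' ι₂≈ι₂' → embL-≈L (ι₁ ⇒T ι₂) (ι₁' ⇒T ι₂') (cong₂ T._⇒_ (e-inj (ι₁≈ι₁' [])) (e-inj (ι₂≈ι₂' [])))
    ; +ₜ-emb        = embL-∪T
    ; ︔ₜ-emb        = embL-·T
    ; +-assoc       = ∪-assoc
    ; +-comm        = ∪-comm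
    ; ︔-assoc       = λ p q r → ≈L-sym (·-assoc p q r)
    ; ︔-unitʳ       = λ p → ≈L-trans (·-cong ≈L-refl embL-εT) (·-identityʳ p)
    ; ︔-unitˡ       = λ p → ≈L-trans (·-cong embL-εT ≈L-refl) (·-identityˡ p)
    ; distribˡ      = ·-distribˡ-∪
    ; distribʳ      = ·-distribʳ-∪
    ; zeroʳ         = λ p → ≈L-trans (·-cong ≈L-refl embL-∅T) (≈L-trans (·-zeroʳ p) (≈L-sym embL-∅T))
    ; zeroˡ         = λ p → ≈L-trans (·-cong embL-∅T ≈L-refl) (≈L-trans (·-zeroˡ p) (≈L-sym embL-∅T))
    ; star-unfold   = λ p → ≈L-trans (∪-cong embL-εT ≈L-refl) (⋆-unfold p)
    ; star-indˡ     = λ p q r h → ⊑⇒∪≈L (⋆-inductionˡ p q r (∪≈L⇒⊑ h))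
    ; star-indʳ     = λ p q r h → ⊑⇒∪≈L (⋆-inductionʳ p q r (∪≈L⇒⊑ h))
    ; residuation₁  = λ ι₁ ι₂ ι₃ h → ⊑⇒∪≈L (test-residuation₁ ι₁ ι₂ ι₃ (∪≈L⇒⊑ h))
    ; residuation₂  = λ ι₁ ι₂ ι₃ h → ⊑⇒∪≈L (test-residuation₂ ι₁ ι₂ ι₃ (∪≈L⇒⊑ h))
    ; test-≤𝟙       = λ ι → ⊑⇒∪≈L (test-⊑ ι εT (T.𝟙-great _))
    ; test-comm     = λ ι₁ ι₂ →
        ≈L-trans (≈L-sym (embL-·T ι₁ ι₂)) (≈L-trans (embL-≈L (ι₁ ·T ι₂) (ι₂ ·T ι₁) (T-comm _ _)) (embL-·T ι₂ ι₁))
    }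
  ; test-idem = λ ι → ≈L-trans (≈L-sym (embL-·T ι ι)) (embL-≈L (ι ·T ι) ι (T-idem _))
  }
  where
  module T = CRL 𝐓
  open FLANG 𝐊 𝐓 e Σ'
  open LanguageProperties 𝐊 𝐓 e Σ'
  open TestLanguageProperties 𝐊 𝐓 e e-inj e-+ e-︔ e-𝟘 e-𝟙 Σ'
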